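{- Let $n$ be a positive integer. There exist positive integers $a,b,c,d$ with $(4abc-1)d=(a+b)n$ if and only if there exist positive integers $x,t,\lambda$ such that $\frac{xn+t}{\lambda}$ is a positive integer and $\frac{n+\lambda}{4xt}$ is a positive integer. -}

module Defs where

open import Data.Nat using (ℕ; _*_; _+_; _<_)
open import Data.Product using (Σ; _×_; ∃-syntax)
open import Relation.Binary.PropositionalEquality using (_≡_)

IsPosIntQuot : ℕ → ℕ → Set
IsPosIntQuot p q = ∃[ k ] (0 < k × p ≡ k * q)

{-# OPTIONS --safe #-}
module Submission where

-- Clearing the denominator turns (4abc − 1)d = (a + b)n into 4abcd = (a + b)n + d.
-- Given a solution, put x = a, t = d and λ = 4acd − n: the cleared equation reads
-- b·(4acd) = bn + (an + d), so λ > 0 and (xn + t)/λ = b, while (n + λ)/(4xt) = c.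
-- Conversely, from xn + t = kλ and n + λ = m·4xt one gets 4xkmt = k(n + λ) = (x + k)n + t,
-- so (a, b, c, d) = (x, k, m, t) is a solution.

open import Defs
open import Data.Nat using (ℕ; suc; _*_; _+_; _∸_; _<_; s≤s; z≤n)
open import Data.Nat.Properties
  using (*-cancelˡ-<; m<m+n; m<n⇒0<n∸m; m+[n∸m]≡n; <⇒≤; m+n∸m≡n; m+n∸n≡m;
         *-distribˡ-∸; *-distribʳ-∸; *-distribˡ-+; *-identityˡ; +-comm; ≤-trans; m≤n+m)
open import Data.Nat.Solver using (module +-*-Solver)
open import Data.Product using (_×_; ∃-syntax; _,_)
open import Function.Bundles using (_⇔_; mk⇔; Equivalence)
open import Relation.Binary.PropositionalEquality using (_≡_; refl; sym; trans; cong; cong₂; subst; module ≡-Reasoning)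

open +-*-Solver
open ≡-Reasoning

*-pos : ∀ {m n} → 0 < m → 0 < n → 0 < m * n
*-pos {suc m} {suc n} _ _ = s≤s z≤n

[m∸1]*n≡o⇔m*n≡o+n : ∀ {m} n o → 0 < m → ((m ∸ 1) * n ≡ o) ⇔ (m * n ≡ o + n)
[m∸1]*n≡o⇔m*n≡o+n {suc m} n o _ = mk⇔ to from
  where
  to : m * n ≡ o → suc m * n ≡ o + n
  to eq = trans (+-comm n (m * n)) (cong (_+ n) eq)

  from : suc m * n ≡ o + n → m * n ≡ o
  from eq = begin
    (suc m ∸ 1) * n   ≡⟨ *-distribʳ-∸ n (suc m) 1 ⟩
    suc m * n ∸ 1 * n ≡⟨ cong₂ _∸_ eq (*-identityˡ n) ⟩
    o + n ∸ n         ≡⟨ m+n∸n≡m o n ⟩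
    o                 ∎

*≡*+⇒< : ∀ m {n o r} → 0 < r → m * o ≡ m * n + r → n < o
*≡*+⇒< m {n} {o} r>0 eq =
  *-cancelˡ-< m n o (subst (m * n <_) (sym eq) (m<m+n (m * n) r>0))

*≡*+⇒*[∸]≡ : ∀ m n o r → m * o ≡ m * n + r → m * (o ∸ n) ≡ r
*≡*+⇒*[∸]≡ m n o r eq = begin
  m * (o ∸ n)       ≡⟨ *-distribˡ-∸ m o n ⟩
  m * o ∸ m * n     ≡⟨ cong (_∸ m * n) eq ⟩
  m * n + r ∸ m * n ≡⟨ m+n∸m≡n (m * n) r ⟩
  r                 ∎

quotients-of-cleared : ∀ n a {b c d} → 0 < b → 0 < c → 0 < d →
  4 * a * b * c * d ≡ (a + b) * n + d →
  ∃[ λ′ ] (0 < λ′ × IsPosIntQuot (a * n + d) λ′ × IsPosIntQuot (n + λ′) (4 * a * d))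
quotients-of-cleared n a {b} {c} {d} b>0 c>0 d>0 cleared =
  L ∸ n , m<n⇒0<n∸m n<L
        , (b , b>0 , sym (*≡*+⇒*[∸]≡ b n L (a * n + d) bL≡bn+an+d))
        , (c , c>0 , n+[L∸n]≡c*4ad)
  where
  L : ℕ
  L = 4 * a * c * d

  bL≡bn+an+d : b * L ≡ b * n + (a * n + d)
  bL≡bn+an+d = begin
    b * L               ≡⟨ solve 4 (λ a b c d → b :* (con 4 :* a :* c :* d) := con 4 :* a :* b :* c :* d) refl a b c d ⟩
    4 * a * b * c * d   ≡⟨ cleared ⟩
    (a + b) * n + d     ≡⟨ solve 4 (λ a b d n → (a :+ b) :* n :+ d := b :* n :+ (a :* n :+ d)) refl a b d n ⟩
    b * n + (a * n + d) ∎

  n<L : n < L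
  n<L = *≡*+⇒< b (≤-trans d>0 (m≤n+m d (a * n))) bL≡bn+an+d

  n+[L∸n]≡c*4ad : n + (L ∸ n) ≡ c * (4 * a * d)
  n+[L∸n]≡c*4ad = trans (m+[n∸m]≡n (<⇒≤ n<L)) (solve 3 (λ a c d → con 4 :* a :* c :* d := c :* (con 4 :* a :* d)) refl a c d)

cleared-of-quotients : ∀ n x t λ′ k m →
  x * n + t ≡ k * λ′ → n + λ′ ≡ m * (4 * x * t) →
  4 * x * k * m * t ≡ (x + k) * n + t
cleared-of-quotients n x t λ′ k m xn+t≡kλ n+λ≡m4xt = begin
  4 * x * k * m * t     ≡⟨ solve 4 (λ x k m t → con 4 :* x :* k :* m :* t := k :* (m :* (con 4 :* x :* t))) refl x k m t ⟩
  k * (m * (4 * x * t)) ≡⟨ cong (k *_) (sym n+λ≡m4xt) ⟩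
  k * (n + λ′)          ≡⟨ *-distribˡ-+ k n λ′ ⟩
  k * n + k * λ′        ≡⟨ cong (k * n +_) (sym xn+t≡kλ) ⟩
  k * n + (x * n + t)   ≡⟨ solve 4 (λ x k n t → k :* n :+ (x :* n :+ t) := (x :+ k) :* n :+ t) refl x k n t ⟩
  (x + k) * n + t       ∎

lemma2p4 : (n : ℕ) → 0 < n →
    (∃[ a ] ∃[ b ] ∃[ c ] ∃[ d ] (0 < a × 0 < b × 0 < c × 0 < d ×
        (4 * a * b * c ∸ 1) * d ≡ (a + b) * n))
    ⇔
    (∃[ x ] ∃[ t ] ∃[ λ′ ] (0 < x × 0 < t × 0 < λ′ ×
        IsPosIntQuot (x * n + t) λ′ × IsPosIntQuot (n + λ′) (4 * x * t)))
lemma2p4 n _ = mk⇔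
  (λ { (a , b , c , d , a>0 , b>0 , c>0 , d>0 , eq) →
       let λ′ , λ′>0 , quot₁ , quot₂ = quotients-of-cleared n a b>0 c>0 d>0 (Equivalence.to (clear a>0 b>0 c>0) eq)
       in a , d , λ′ , a>0 , d>0 , λ′>0 , quot₁ , quot₂ })
  (λ { (x , t , λ′ , x>0 , t>0 , _ , (k , k>0 , xn+t≡kλ) , (m , m>0 , n+λ≡m4xt)) →
       x , k , m , t , x>0 , k>0 , m>0 , t>0 ,
       Equivalence.from (clear x>0 k>0 m>0) (cleared-of-quotients n x t λ′ k m xn+t≡kλ n+λ≡m4xt) })
  where
  clear : ∀ {a b c d} → 0 < a → 0 < b → 0 < c →
    ((4 * a * b * c ∸ 1) * d ≡ (a + b) * n) ⇔ (4 * a * b * c * d ≡ (a + b) * n + d)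
  clear {a} {b} {c} {d} a>0 b>0 c>0 =
    [m∸1]*n≡o⇔m*n≡o+n d ((a + b) * n) (*-pos (*-pos (*-pos {4} (s≤s z≤n) a>0) b>0) c>0)
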